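{- Let $X$ be a set of variables. Let $\langle C,L\rangle$ be coherent, with $1 \in L$, $C$ consistent, and $C$ closed under cutting planes with respect to $L$. Then $\mathfrak{M}(C,L)$ is a model of $\mathbf{LIRR}$.
   Context: A cone in $\mathbb{Q}[X]$ contains $0$ and is closed under addition and non-negative rational scaling; $\mathrm{units}(C)=\{p:p\in C,-p\in C\}$; $C$ is regular if $1\in C$ and $\mathrm{units}(C)$ is an ideal; consistent if $C\ne\mathbb{Q}[X]$. A set $C$ is closed under cutting planes w.r.t. $L\subseteq\mathbb{Q}[X]$ if for all $a,b\in\mathbb{Z}$ with $a>0$ and all $p\in L$, $ap+b\in C$ implies $p+\lfloor b/a\rfloor\in C$. A point lattice is a set $\{\sum_i n_iv_i : n_i\in\mathbb{Z}\}$ for finitely many $v_i$. A pair $\langle C,L\rangle$ with $C$ a regular cone is coherent if $L=\mathrm{units}(C)+L_0$ for some point lattice $L_0$. $\sigma^Z_{or}$ is the ordered-ring signature ($+,\cdot,0,1,=,\le$) plus a unary predicate $\mathit{Int}$; $\sigma^Z_{or}(X)$ adds $X$ as constants. $\mathfrak{M}(C,L)$ is the $\sigma^Z_{or}(X)$-structure with universe and ring operations those of $\mathbb{Q}[X]/I$, $I=\mathrm{units}(C)$, each $x\in X$ interpreted as $x+I$, $\le$ interpreted as $\{(p+I,q+I):q-p\in C\}$, and $\mathit{Int}$ interpreted as $\{p+I:p\in L\}$. $\mathbf{LIRR}$ is axiomatized by: the commutative ring axioms; reflexivity, transitivity, antisymmetry of $\le$; $\forall x,y,z\,(x\le y\Rightarrow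 x+z\le y+z)$; $0\le1\land0\ne1$; for each integer $n\ge1$, $\exists x\,(x+\dots+x=1)$; for each integer $n\ge1$, $\forall x\,(0\le x+\dots+x\Rightarrow0\le x)$ ($n$ summands); $\mathit{Int}(1)$; $\forall x,y\,(\mathit{Int}(x)\land\mathit{Int}(y)\Rightarrow\mathit{Int}(x+y))$; $\forall x,y\,(\mathit{Int}(x)\land x+y=0\Rightarrow\mathit{Int}(y))$; and for all integers $n>0$ and $m$, $\forall x\,(\mathit{Int}(x)\land 0\le nx+m\Rightarrow 0\le x+\lfloor m/n\rfloor)$ (integer multiples written as iterated sums). -}

module Defs where

open import Data.Nat using (ℕ; zero; suc)
open import Data.Integer using (ℤ; +_; -[1+_])
open import Data.Integer.Base using (_/ℕ_)
open import Data.Rational using (ℚ; 0ℚ; 1ℚ) renaming (_≤_ to _≤ℚ_; _+_ to _+ℚ_; _*_ to _*ℚ_; -_ to -ℚ_; _/_ to _/ℚ_)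
open import Data.Fin using (Fin; zero; suc)
open import Data.Product using (Σ; ∃; _×_; _,_)
open import Relation.Nullary using (¬_)
open import Function.Bundles using (_⇔_)

-- The polynomial ring ℚ[X], as the free commutative ℚ-algebra on X:
-- polynomial expressions modulo the least congruence making them a
-- commutative ring in which  con : ℚ → ℚ[X]  is a ring homomorphism.

infixl 6 _⊕_
infixl 7 _⊗_


data Poly (X : Set) : Set where
  con  : ℚ → Poly X
  var  : X → Poly X
  _⊕_  : Poly X → Poly X → Poly X
  _⊗_  : Poly X → Poly X → Poly X

module _ {X : Set} where

  negₚ : Poly X → Poly X
  negₚ p = con (-ℚ 1ℚ) ⊗ p

  infix 4 _≈ₚ_
  data _≈ₚ_ : Poly X → Poly X → Set where
    ≈-reflₚ    : ∀ {p} → p ≈ₚ p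
    ≈-symₚ     : ∀ {p q} → p ≈ₚ q → q ≈ₚ p
    ≈-transₚ   : ∀ {p q r} → p ≈ₚ q → q ≈ₚ r → p ≈ₚ r
    ⊕-congₚ    : ∀ {p p' q q'} → p ≈ₚ p' → q ≈ₚ q' → p ⊕ q ≈ₚ p' ⊕ q'
    ⊗-congₚ    : ∀ {p p' q q'} → p ≈ₚ p' → q ≈ₚ q' → p ⊗ q ≈ₚ p' ⊗ q'
    ⊕-assocₚ   : ∀ p q r → (p ⊕ q) ⊕ r ≈ₚ p ⊕ (q ⊕ r)
    ⊕-commₚ    : ∀ p q → p ⊕ q ≈ₚ q ⊕ p
    ⊕-identityₚ : ∀ p → con 0ℚ ⊕ p ≈ₚ p
    ⊕-inverseₚ : ∀ p → p ⊕ negₚ p ≈ₚ con 0ℚ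
    ⊗-assocₚ   : ∀ p q r → (p ⊗ q) ⊗ r ≈ₚ p ⊗ (q ⊗ r)
    ⊗-commₚ    : ∀ p q → p ⊗ q ≈ₚ q ⊗ p
    ⊗-identityₚ : ∀ p → con 1ℚ ⊗ p ≈ₚ p
    distribₚ   : ∀ p q r → p ⊗ (q ⊕ r) ≈ₚ (p ⊗ q) ⊕ (p ⊗ r)
    con-+ₚ     : ∀ a b → con a ⊕ con b ≈ₚ con (a +ℚ b)
    con-*ₚ     : ∀ a b → con a ⊗ con b ≈ₚ con (a *ℚ b)

  conℤ : ℤ → Poly X
  conℤ n = con (n /ℚ 1)

  Respects : (Poly X → Set) → Set
  Respects S = ∀ {p q} → p ≈ₚ q → S p → S q

  record IsCone (C : Poly X → Set) : Set where
    field
      respects : Respects C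
      zero∈    : C (con 0ℚ)
      +-closed : ∀ {p q} → C p → C q → C (p ⊕ q)
      scale    : ∀ {q : ℚ} {p} → 0ℚ ≤ℚ q → C p → C (con q ⊗ p)

  units : (Poly X → Set) → Poly X → Set
  units C p = C p × C (negₚ p)

  record IsIdeal (I : Poly X → Set) : Set where
    field
      zero∈    : I (con 0ℚ)
      +-closed : ∀ {p q} → I p → I q → I (p ⊕ q)
      *-closed : ∀ r {p} → I p → I (r ⊗ p)

  record IsRegularCone (C : Poly X → Set) : Set where
    field
      isCone     : IsCone C
      one∈       : C (con 1ℚ)
      unitsIdeal : IsIdeal (units C)

  Consistent : (Poly X → Set) → Set
  Consistent C = ¬ (∀ p → C p)

  -- cutting planes: for a, b ∈ ℤ with a > 0 (a written as suc k)
  CuttingPlaneClosed : (C L : Poly X → Set) → Set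
  CuttingPlaneClosed C L =
    ∀ (k : ℕ) (b : ℤ) (p : Poly X) → L p →
      C (conℤ (+ suc k) ⊗ p ⊕ conℤ b) → C (p ⊕ conℤ (b /ℕ suc k))

  lincomb : ∀ {k} → (Fin k → ℤ) → (Fin k → Poly X) → Poly X
  lincomb {zero}  ns vs = con 0ℚ
  lincomb {suc k} ns vs = conℤ (ns zero) ⊗ vs zero ⊕ lincomb (λ i → ns (suc i)) (λ i → vs (suc i))

  PointLattice : ∀ {k} → (Fin k → Poly X) → Poly X → Set
  PointLattice vs l = Σ (Fin _ → ℤ) λ ns → l ≈ₚ lincomb ns vs

  Coherent : (C L : Poly X → Set) → Set
  Coherent C L =
    IsRegularCone C ×
    Σ ℕ λ k → Σ (Fin k → Poly X) λ vs →
      ∀ p → L p ⇔ (Σ (Poly X) λ u → Σ (Poly X) λ l →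
                     units C u × PointLattice vs l × p ≈ₚ u ⊕ l)

-- σ^Z_or(X)-structures, with the interpretation of "=" given as a
-- relation _≈_ (the structure is the quotient by _≈_).

record Structure (X : Set) : Set₁ where
  infix 4 _≈_ _≤_
  infixl 6 _+_
  infixl 7 _·_
  field
    Carrier : Set
    _≈_     : Carrier → Carrier → Set
    _+_ _·_ : Carrier → Carrier → Carrier
    0# 1#   : Carrier
    _≤_     : Carrier → Carrier → Set
    Int     : Carrier → Set
    const   : X → Carrier

  -- x + … + x  with (suc n) summands
  times : ℕ → Carrier → Carrier
  times zero    x = x
  times (suc n) x = times n x + x

  -- c is the value of the integer literal m (0, 1+…+1, or the additive
  -- inverse of 1+…+1)
  IntLit : ℤ → Carrier → Set
  IntLit (+ zero)  c = c ≈ 0#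
  IntLit (+ suc k) c = c ≈ times k 1#
  IntLit -[1+ k ]  c = c + times k 1# ≈ 0#

module _ {X : Set} (M : Structure X) where
  open Structure M

  -- well-definedness: _≈_ is a congruence for all symbols, so that the
  -- quotient is a genuine structure
  record IsWellDefined : Set where
    field
      ≈-refl  : ∀ {x} → x ≈ x
      ≈-sym   : ∀ {x y} → x ≈ y → y ≈ x
      ≈-trans : ∀ {x y z} → x ≈ y → y ≈ z → x ≈ z
      +-cong  : ∀ {x x' y y'} → x ≈ x' → y ≈ y' → x + y ≈ x' + y'
      ·-cong  : ∀ {x x' y y'} → x ≈ x' → y ≈ y' → x · y ≈ x' · y'
      ≤-cong  : ∀ {x x' y y'} → x ≈ x' → y ≈ y' → x ≤ y → x' ≤ y'
      Int-cong : ∀ {x x'} → x ≈ x' → Int x → Int x'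

  record IsLIRRModel : Set where
    field
      +-assoc    : ∀ x y z → (x + y) + z ≈ x + (y + z)
      +-comm     : ∀ x y → x + y ≈ y + x
      +-identity : ∀ x → 0# + x ≈ x
      +-inverse  : ∀ x → Σ Carrier λ y → x + y ≈ 0#
      ·-assoc    : ∀ x y z → (x · y) · z ≈ x · (y · z)
      ·-comm     : ∀ x y → x · y ≈ y · x
      ·-identity : ∀ x → 1# · x ≈ x
      distrib    : ∀ x y z → x · (y + z) ≈ x · y + x · z
      ≤-refl     : ∀ x → x ≤ x
      ≤-trans    : ∀ x y z → x ≤ y → y ≤ z → x ≤ z
      ≤-antisym  : ∀ x y → x ≤ y → y ≤ x → x ≈ y
      ≤-+        : ∀ x y z → x ≤ y → x + z ≤ y + z
      0≤1        : 0# ≤ 1#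
      0≉1        : ¬ (0# ≈ 1#)
      -- for each n ≥ 1 (n = suc k summands)
      divisible  : ∀ k → Σ Carrier λ x → times k x ≈ 1#
      torsionFree : ∀ k x → 0# ≤ times k x → 0# ≤ x
      Int-1      : Int 1#
      Int-+      : ∀ x y → Int x → Int y → Int (x + y)
      Int-neg    : ∀ x y → Int x → x + y ≈ 0# → Int y
      -- cutting plane axiom, n = suc k > 0, m ∈ ℤ
      Int-cut    : ∀ (k : ℕ) (m : ℤ) x c d → IntLit m c → IntLit (m /ℕ suc k) d →
                   Int x → 0# ≤ times k x + c → 0# ≤ x + d

𝔐 : {X : Set} → (C L : Poly X → Set) → Structure X
𝔐 {X} C L = record
  { Carrier = Poly X
  ; _≈_     = λ p q → units C (p ⊕ negₚ q)
  ; _+_     = _⊕_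
  ; _·_     = _⊗_
  ; 0#      = con 0ℚ
  ; 1#      = con 1ℚ
  ; _≤_     = λ p q → C (q ⊕ negₚ p)
  ; Int     = L
  ; const   = var
  }

-- 𝔐(C, L) is ℚ[X] modulo the ideal units(C), so it is a commutative ring, and
-- since C is a cone whose lineality space is exactly what is quotiented out, its
-- order is a partial order compatible with addition.  Dividing by a positive
-- integer n means scaling by the rational 1/n, which maps C into itself; this gives
-- divisibility and torsion-freeness.  If 0 ≈ 1 then 1 ∈ units(C), so units(C)
-- would be everything, contradicting consistency.  Finally L = units(C) + L₀ is a
-- subgroup made of whole cosets of units(C), and once integer literals are read
-- as constant polynomials the cutting-plane axiom is exactly the closure of C
-- under cutting planes.
module Submission where

open import Defs
open import Algebra.Bundles using (CommutativeRing)
import Algebra.Consequences.Setoid as SetoidConsequences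
import Algebra.Properties.Group as GroupProperties
import Algebra.Properties.Ring as RingProperties
open import Algebra.Solver.Ring.AlmostCommutativeRing
  using (fromCommutativeRing; _-Raw-AlmostCommutative⟶_)
open import Data.Fin using (Fin; zero; suc)
open import Data.Integer as ℤ using (ℤ; +_; -[1+_])
open import Data.Integer.Base using (_/ℕ_)
import Data.Integer.Properties as ℤP
open import Data.Maybe using (Maybe; just; nothing)
open import Data.Nat using (ℕ; zero; suc)
open import Data.Product using (Σ; _×_; _,_; proj₁)
open import Data.Rational as ℚ using (ℚ; 0ℚ; 1ℚ; 1/_; NonZero)
  renaming (_≤_ to _≤ℚ_; _+_ to _+ℚ_; _*_ to _*ℚ_; -_ to -ℚ_; _/_ to _/ℚ_)
import Data.Rational.Properties as ℚP
import Data.Rational.Unnormalised as ℚᵘ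
import Data.Rational.Unnormalised.Properties as ℚᵘP
open import Function.Bundles using (_⇔_; Equivalence)
open import Level using (0ℓ)
open import Relation.Binary.Bundles using (Setoid)
import Relation.Binary.Reasoning.Setoid as SetoidReasoning
open import Relation.Binary.PropositionalEquality using (_≡_; refl; cong; cong₂; sym)
open import Relation.Nullary using (¬_; yes; no)

/1-homo-+ : ∀ a b → (a ℤ.+ b) /ℚ 1 ≡ a /ℚ 1 +ℚ b /ℚ 1
/1-homo-+ a b = ℚP.toℚᵘ-injective (begin
  ℚ.toℚᵘ ((a ℤ.+ b) /ℚ 1)                  ≈⟨ ℚP.toℚᵘ-fromℚᵘ (ℚᵘ.mkℚᵘ (a ℤ.+ b) 0) ⟩
  ℚᵘ.mkℚᵘ (a ℤ.+ b) 0                      ≈⟨ integer-sum ⟩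
  ℚᵘ.mkℚᵘ a 0 ℚᵘ.+ ℚᵘ.mkℚᵘ b 0             ≈⟨ ℚᵘP.+-cong (ℚP.toℚᵘ-fromℚᵘ (ℚᵘ.mkℚᵘ a 0)) (ℚP.toℚᵘ-fromℚᵘ (ℚᵘ.mkℚᵘ b 0)) ⟨
  ℚ.toℚᵘ (a /ℚ 1) ℚᵘ.+ ℚ.toℚᵘ (b /ℚ 1)     ≈⟨ ℚP.toℚᵘ-homo-+ (a /ℚ 1) (b /ℚ 1) ⟨
  ℚ.toℚᵘ (a /ℚ 1 +ℚ b /ℚ 1)                ∎)
  where
  open ℚᵘP.≃-Reasoning
  integer-sum : ℚᵘ.mkℚᵘ (a ℤ.+ b) 0 ℚᵘ.≃ ℚᵘ.mkℚᵘ a 0 ℚᵘ.+ ℚᵘ.mkℚᵘ b 0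
  integer-sum = ℚᵘ.*≡* (cong (ℤ._* + 1) (sym (cong₂ ℤ._+_ (ℤP.*-identityʳ a) (ℤP.*-identityʳ b))))

/1-homo-neg : ∀ a → (ℤ.- a) /ℚ 1 ≡ -ℚ (a /ℚ 1)
/1-homo-neg (+ zero)  = refl
/1-homo-neg (+ suc n) = refl
/1-homo-neg -[1+ n ]  = sym (GroupProperties.⁻¹-involutive ℚP.+-0-group _)

+suc/1-nonZero : ∀ k → NonZero (+ suc k /ℚ 1)
+suc/1-nonZero k = ℚP.pos⇒nonZero (+ suc k /ℚ 1) {{ℚP.normalize-pos (suc k) 1}}

1/suc : ℕ → ℚ
1/suc k = (1/ (+ suc k /ℚ 1)) {{+suc/1-nonZero k}}

0≤1/suc : ∀ k → 0ℚ ≤ℚ 1/suc k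
0≤1/suc k = ℚP.nonNegative⁻¹ (1/suc k) {{ℚP.pos⇒nonNeg (1/suc k) {{1/-positive}}}}
  where
  1/-positive : ℚ.Positive (1/suc k)
  1/-positive = ℚP.1/pos⇒pos (+ suc k /ℚ 1) {{ℚP.normalize-pos (suc k) 1}}

+suc/1*1/suc : ∀ k → (+ suc k /ℚ 1) *ℚ 1/suc k ≡ 1ℚ
+suc/1*1/suc k = ℚP.*-inverseʳ (+ suc k /ℚ 1) {{+suc/1-nonZero k}}

module _ {X : Set} where

  Poly-setoid : Setoid 0ℓ 0ℓ
  Poly-setoid = record
    { Carrier       = Poly X
    ; _≈_           = _≈ₚ_
    ; isEquivalence = record { refl = ≈-reflₚ ; sym = ≈-symₚ ; trans = ≈-transₚ }
    }

  open SetoidConsequences Poly-setoid using (comm∧idˡ⇒id; comm∧invʳ⇒inv; comm∧distrˡ⇒distr)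

  Poly-commutativeRing : CommutativeRing 0ℓ 0ℓ
  Poly-commutativeRing = record
    { Carrier = Poly X ; _≈_ = _≈ₚ_ ; _+_ = _⊕_ ; _*_ = _⊗_ ; -_ = negₚ ; 0# = con 0ℚ ; 1# = con 1ℚ
    ; isCommutativeRing = record
      { isRing = record
        { +-isAbelianGroup = record
          { isGroup = record
            { isMonoid = record
              { isSemigroup = record
                { isMagma = record { isEquivalence = Setoid.isEquivalence Poly-setoid ; ∙-cong = ⊕-congₚ }
                ; assoc   = ⊕-assocₚ
                }
              ; identity = comm∧idˡ⇒id ⊕-commₚ ⊕-identityₚ
              }
            ; inverse = comm∧invʳ⇒inv ⊕-commₚ ⊕-inverseₚ
            ; ⁻¹-cong = ⊗-congₚ ≈-reflₚ
            }
          ; comm = ⊕-commₚ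
          }
        ; *-cong     = ⊗-congₚ
        ; *-assoc    = ⊗-assocₚ
        ; *-identity = comm∧idˡ⇒id ⊗-commₚ ⊗-identityₚ
        ; distrib    = comm∧distrˡ⇒distr ⊕-congₚ ⊗-commₚ distribₚ
        }
      ; *-comm = ⊗-commₚ
      }
    }

  ≡⇒≈ₚ : ∀ {p q : Poly X} → p ≡ q → p ≈ₚ q
  ≡⇒≈ₚ refl = ≈-reflₚ

  con-neg : ∀ a → negₚ (con {X} a) ≈ₚ con (-ℚ a)
  con-neg a = ≈-transₚ (con-*ₚ _ a) (≡⇒≈ₚ (cong con (RingProperties.-1*x≈-x ℚP.+-*-ring a)))

  con-homomorphism : ℚ.+-*-rawRing -Raw-AlmostCommutative⟶ fromCommutativeRing Poly-commutativeRing
  con-homomorphism = record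
    { ⟦_⟧    = con
    ; +-homo = λ a b → ≈-symₚ (con-+ₚ a b)
    ; *-homo = λ a b → ≈-symₚ (con-*ₚ a b)
    ; -‿homo = λ a → ≈-symₚ (con-neg a)
    ; 0-homo = ≈-reflₚ
    ; 1-homo = ≈-reflₚ
    }

  con-≟ : ∀ a b → Maybe (con {X} a ≈ₚ con b)
  con-≟ a b with a ℚP.≟ b
  ... | yes refl = just ≈-reflₚ
  ... | no _     = nothing

  open import Algebra.Solver.Ring ℚ.+-*-rawRing (fromCommutativeRing Poly-commutativeRing) con-homomorphism con-≟
    using (solve; _:=_; _:+_; _:*_; :-_; _:-_) renaming (con to :con)
  open SetoidReasoning Poly-setoid

  conℤ-+ : ∀ a b → conℤ {X} a ⊕ conℤ b ≈ₚ conℤ (a ℤ.+ b)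
  conℤ-+ a b = ≈-transₚ (con-+ₚ _ _) (≡⇒≈ₚ (cong con (sym (/1-homo-+ a b))))

  negₚ-conℤ : ∀ a → negₚ (conℤ {X} a) ≈ₚ conℤ (ℤ.- a)
  negₚ-conℤ a = ≈-transₚ (con-neg _) (≡⇒≈ₚ (cong con (sym (/1-homo-neg a))))

  conℤ-suc⊗inverse : ∀ k → conℤ {X} (+ suc k) ⊗ con (1/suc k) ≈ₚ con 1ℚ
  conℤ-suc⊗inverse k = ≈-transₚ (con-*ₚ _ _) (≡⇒≈ₚ (cong con (+suc/1*1/suc k)))

  lincomb-+ : ∀ {k} (ns ms : Fin k → ℤ) (vs : Fin k → Poly X) →
              lincomb ns vs ⊕ lincomb ms vs ≈ₚ lincomb (λ i → ns i ℤ.+ ms i) vs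
  lincomb-+ {zero}  ns ms vs = ⊕-identityₚ _
  lincomb-+ {suc k} ns ms vs = begin
    (n ⊗ v ⊕ r) ⊕ (m ⊗ v ⊕ r')  ≈⟨ solve 5 (λ n m v r r' → (n :* v :+ r) :+ (m :* v :+ r') := (n :+ m) :* v :+ (r :+ r'))
                                          ≈-reflₚ n m v r r' ⟩
    (n ⊕ m) ⊗ v ⊕ (r ⊕ r')      ≈⟨ ⊕-congₚ (⊗-congₚ (conℤ-+ (ns zero) (ms zero)) ≈-reflₚ)
                                          (lincomb-+ (λ i → ns (suc i)) (λ i → ms (suc i)) (λ i → vs (suc i))) ⟩
    lincomb (λ i → ns i ℤ.+ ms i) vs ∎
    where
    n m v r r' : Poly X
    n = conℤ (ns zero)
    m = conℤ (ms zero)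
    v = vs zero
    r = lincomb (λ i → ns (suc i)) (λ i → vs (suc i))
    r' = lincomb (λ i → ms (suc i)) (λ i → vs (suc i))

  lincomb-neg : ∀ {k} (ns : Fin k → ℤ) (vs : Fin k → Poly X) →
                negₚ (lincomb ns vs) ≈ₚ lincomb (λ i → ℤ.- ns i) vs
  lincomb-neg {zero}  ns vs = con-neg 0ℚ
  lincomb-neg {suc k} ns vs = begin
    negₚ (n ⊗ v ⊕ r)          ≈⟨ solve 3 (λ n v r → :- (n :* v :+ r) := (:- n) :* v :+ (:- r)) ≈-reflₚ n v r ⟩
    negₚ n ⊗ v ⊕ negₚ r       ≈⟨ ⊕-congₚ (⊗-congₚ (negₚ-conℤ (ns zero)) ≈-reflₚ)
                                        (lincomb-neg (λ i → ns (suc i)) (λ i → vs (suc i))) ⟩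
    lincomb (λ i → ℤ.- ns i) vs ∎
    where
    n v r : Poly X
    n = conℤ (ns zero)
    v = vs zero
    r = lincomb (λ i → ns (suc i)) (λ i → vs (suc i))

  PointLattice-+ : ∀ {k} {vs : Fin k → Poly X} {l l'} →
                   PointLattice vs l → PointLattice vs l' → PointLattice vs (l ⊕ l')
  PointLattice-+ {vs = vs} (ns , l≈) (ms , l'≈) =
    (λ i → ns i ℤ.+ ms i) , ≈-transₚ (⊕-congₚ l≈ l'≈) (lincomb-+ ns ms vs)

  PointLattice-neg : ∀ {k} {vs : Fin k → Poly X} {l} →
                     PointLattice vs l → PointLattice vs (negₚ l)
  PointLattice-neg {vs = vs} (ns , l≈) =
    (λ i → ℤ.- ns i) , ≈-transₚ (⊗-congₚ ≈-reflₚ l≈) (lincomb-neg ns vs)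

  UnitsPlusLattice : (C : Poly X → Set) {k : ℕ} → (Fin k → Poly X) → Poly X → Set
  UnitsPlusLattice C vs p =
    Σ (Poly X) λ u → Σ (Poly X) λ l → units C u × PointLattice vs l × p ≈ₚ u ⊕ l

  module RegularCone {C : Poly X → Set} (reg : IsRegularCone C) where
    open IsRegularCone reg
    open IsCone isCone renaming (respects to C-respects; zero∈ to 0∈C; +-closed to C-+; scale to C-scale)
    open IsIdeal unitsIdeal renaming (zero∈ to 0∈units; +-closed to units-+; *-closed to units-*)

    -- the equality and the order of 𝔐 C L, which do not depend on L
    infix 4 _≈ᵤ_ _≤ᶜ_
    _≈ᵤ_ _≤ᶜ_ : Poly X → Poly X → Set
    p ≈ᵤ q = units C (p ⊕ negₚ q)
    p ≤ᶜ q = C (q ⊕ negₚ p)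

    units-respects : Respects (units C)
    units-respects e (p∈ , -p∈) = C-respects e p∈ , C-respects (⊗-congₚ ≈-reflₚ e) -p∈

    units-neg : ∀ {p} → units C p → units C (negₚ p)
    units-neg {p} (p∈ , -p∈) = -p∈ , C-respects (solve 1 (λ p → p := :- (:- p)) ≈-reflₚ p) p∈

    ≈ₚ⇒≈ᵤ : ∀ {p q} → p ≈ₚ q → p ≈ᵤ q
    ≈ₚ⇒≈ᵤ {p} {q} p≈q = units-respects (begin
      con 0ℚ        ≈⟨ solve 1 (λ q → :con 0ℚ := q :- q) ≈-reflₚ q ⟩
      q ⊕ negₚ q    ≈⟨ ⊕-congₚ (≈-symₚ p≈q) ≈-reflₚ ⟩
      p ⊕ negₚ q    ∎) 0∈units

    ≈ᵤ-refl : ∀ {p} → p ≈ᵤ p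
    ≈ᵤ-refl = ≈ₚ⇒≈ᵤ ≈-reflₚ

    ≈ᵤ-sym : ∀ {p q} → p ≈ᵤ q → q ≈ᵤ p
    ≈ᵤ-sym {p} {q} e = units-respects (solve 2 (λ p q → :- (p :- q) := q :- p) ≈-reflₚ p q) (units-neg e)

    ≈ᵤ-trans : ∀ {p q r} → p ≈ᵤ q → q ≈ᵤ r → p ≈ᵤ r
    ≈ᵤ-trans {p} {q} {r} e f =
      units-respects (solve 3 (λ p q r → (p :- q) :+ (q :- r) := p :- r) ≈-reflₚ p q r) (units-+ e f)

    ⊕-cong-≈ᵤ : ∀ {p p' q q'} → p ≈ᵤ p' → q ≈ᵤ q' → p ⊕ q ≈ᵤ p' ⊕ q'
    ⊕-cong-≈ᵤ {p} {p'} {q} {q'} e f = units-respects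
      (solve 4 (λ p p' q q' → (p :- p') :+ (q :- q') := (p :+ q) :- (p' :+ q')) ≈-reflₚ p p' q q')
      (units-+ e f)

    ⊗-cong-≈ᵤ : ∀ {p p' q q'} → p ≈ᵤ p' → q ≈ᵤ q' → p ⊗ q ≈ᵤ p' ⊗ q'
    ⊗-cong-≈ᵤ {p} {p'} {q} {q'} e f = units-respects
      (solve 4 (λ p p' q q' → q :* (p :- p') :+ p' :* (q :- q') := (p :* q) :- (p' :* q')) ≈-reflₚ p p' q q')
      (units-+ (units-* q e) (units-* p' f))

    ≤ᶜ-respects-≈ᵤ : ∀ {p p' q q'} → p ≈ᵤ p' → q ≈ᵤ q' → p ≤ᶜ q → p' ≤ᶜ q'
    ≤ᶜ-respects-≈ᵤ {p} {p'} {q} {q'} (p-p'∈ , _) (_ , q'-q∈) p≤q = C-respects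
      (solve 4 (λ p p' q q' → ((q :- p) :+ :- (q :- q')) :+ (p :- p') := q' :- p') ≈-reflₚ p p' q q')
      (C-+ (C-+ p≤q q'-q∈) p-p'∈)

    ≤ᶜ-refl : ∀ p → p ≤ᶜ p
    ≤ᶜ-refl p = C-respects (≈-symₚ (⊕-inverseₚ p)) 0∈C

    ≤ᶜ-trans : ∀ p q r → p ≤ᶜ q → q ≤ᶜ r → p ≤ᶜ r
    ≤ᶜ-trans p q r p≤q q≤r =
      C-respects (solve 3 (λ p q r → (r :- q) :+ (q :- p) := r :- p) ≈-reflₚ p q r) (C-+ q≤r p≤q)

    ≤ᶜ-antisym : ∀ p q → p ≤ᶜ q → q ≤ᶜ p → p ≈ᵤ q
    ≤ᶜ-antisym p q p≤q q≤p = q≤p , C-respects (solve 2 (λ p q → q :- p := :- (p :- q)) ≈-reflₚ p q) p≤q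

    ⊕-monoˡ-≤ᶜ : ∀ p q r → p ≤ᶜ q → p ⊕ r ≤ᶜ q ⊕ r
    ⊕-monoˡ-≤ᶜ p q r =
      C-respects (solve 3 (λ p q r → q :- p := (q :+ r) :- (p :+ r)) ≈-reflₚ p q r)

    ∈⇒0≤ᶜ : ∀ {p} → C p → con 0ℚ ≤ᶜ p
    ∈⇒0≤ᶜ {p} = C-respects (solve 1 (λ p → p := p :- :con 0ℚ) ≈-reflₚ p)

    0≤ᶜ⇒∈ : ∀ {p} → con 0ℚ ≤ᶜ p → C p
    0≤ᶜ⇒∈ {p} = C-respects (solve 1 (λ p → p :- :con 0ℚ := p) ≈-reflₚ p)

    0≤ᶜ1 : con 0ℚ ≤ᶜ con 1ℚ
    0≤ᶜ1 = ∈⇒0≤ᶜ one∈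

    consistent⇒0≉ᵤ1 : Consistent C → ¬ (con 0ℚ ≈ᵤ con 1ℚ)
    consistent⇒0≉ᵤ1 consistent 0≈1 = consistent λ p → proj₁
      (units-respects (solve 1 (λ p → (:- p) :* (:con 0ℚ :- :con 1ℚ) := p) ≈-reflₚ p) (units-* (negₚ p) 0≈1))

    conℤ-suc⊗-cancel : ∀ k {p} → C (conℤ (+ suc k) ⊗ p) → C p
    conℤ-suc⊗-cancel k {p} np∈ = C-respects inverse-cancels (C-scale (0≤1/suc k) np∈)
      where
      inverse-cancels : con (1/suc k) ⊗ (conℤ (+ suc k) ⊗ p) ≈ₚ p
      inverse-cancels = begin
        con (1/suc k) ⊗ (conℤ (+ suc k) ⊗ p)   ≈⟨ solve 3 (λ i n p → i :* (n :* p) := (n :* i) :* p) ≈-reflₚ _ _ p ⟩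
        (conℤ (+ suc k) ⊗ con (1/suc k)) ⊗ p   ≈⟨ ⊗-congₚ (conℤ-suc⊗inverse k) ≈-reflₚ ⟩
        con 1ℚ ⊗ p                             ≈⟨ ⊗-identityₚ p ⟩
        p                                      ∎

    UnitsPlusLattice-respects-≈ᵤ : ∀ {k} {vs : Fin k → Poly X} {p q} →
                                   p ≈ᵤ q → UnitsPlusLattice C vs p → UnitsPlusLattice C vs q
    UnitsPlusLattice-respects-≈ᵤ {p = p} {q} p≈q (u , l , u∈ , l∈ , p≈u+l) =
      u ⊕ negₚ d , l , units-+ u∈ (units-neg p≈q) , l∈ , (begin
        q                    ≈⟨ solve 2 (λ p q → q := p :- (p :- q)) ≈-reflₚ p q ⟩
        p ⊕ negₚ d           ≈⟨ ⊕-congₚ p≈u+l ≈-reflₚ ⟩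
        (u ⊕ l) ⊕ negₚ d     ≈⟨ solve 3 (λ u l d → (u :+ l) :- d := (u :- d) :+ l) ≈-reflₚ u l d ⟩
        (u ⊕ negₚ d) ⊕ l     ∎)
      where
      d : Poly X
      d = p ⊕ negₚ q

    UnitsPlusLattice-+ : ∀ {k} {vs : Fin k → Poly X} {p q} →
                         UnitsPlusLattice C vs p → UnitsPlusLattice C vs q → UnitsPlusLattice C vs (p ⊕ q)
    UnitsPlusLattice-+ {p = p} {q} (u , l , u∈ , l∈ , p≈u+l) (u' , l' , u'∈ , l'∈ , q≈u'+l') =
      u ⊕ u' , l ⊕ l' , units-+ u∈ u'∈ , PointLattice-+ l∈ l'∈ , (begin
        p ⊕ q                  ≈⟨ ⊕-congₚ p≈u+l q≈u'+l' ⟩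
        (u ⊕ l) ⊕ (u' ⊕ l')    ≈⟨ solve 4 (λ u l u' l' → (u :+ l) :+ (u' :+ l') := (u :+ u') :+ (l :+ l')) ≈-reflₚ u l u' l' ⟩
        (u ⊕ u') ⊕ (l ⊕ l')    ∎)

    UnitsPlusLattice-neg : ∀ {k} {vs : Fin k → Poly X} {p} →
                           UnitsPlusLattice C vs p → UnitsPlusLattice C vs (negₚ p)
    UnitsPlusLattice-neg (u , l , u∈ , l∈ , p≈u+l) =
      negₚ u , negₚ l , units-neg u∈ , PointLattice-neg l∈ ,
      ≈-transₚ (⊗-congₚ ≈-reflₚ p≈u+l) (solve 2 (λ u l → :- (u :+ l) := (:- u) :+ (:- l)) ≈-reflₚ u l)

  module _ {C L : Poly X → Set} (reg : IsRegularCone C) {k : ℕ} (vs : Fin k → Poly X)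
           (L⇔ : ∀ p → L p ⇔ UnitsPlusLattice C vs p) where
    open RegularCone reg
    open Structure (𝔐 C L) using (times; IntLit)

    L-respects-≈ᵤ : ∀ {p q} → p ≈ᵤ q → L p → L q
    L-respects-≈ᵤ {p} {q} p≈q p∈ =
      Equivalence.from (L⇔ q) (UnitsPlusLattice-respects-≈ᵤ p≈q (Equivalence.to (L⇔ p) p∈))

    L-+ : ∀ p q → L p → L q → L (p ⊕ q)
    L-+ p q p∈ q∈ =
      Equivalence.from (L⇔ (p ⊕ q)) (UnitsPlusLattice-+ (Equivalence.to (L⇔ p) p∈) (Equivalence.to (L⇔ q) q∈))

    L-neg : ∀ p q → L p → p ⊕ q ≈ᵤ con 0ℚ → L q
    L-neg p q p∈ p+q≈0 = L-respects-≈ᵤ -p≈q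
      (Equivalence.from (L⇔ (negₚ p)) (UnitsPlusLattice-neg (Equivalence.to (L⇔ p) p∈)))
      where
      -p≈q : negₚ p ≈ᵤ q
      -p≈q = units-respects (solve 2 (λ p q → :- ((p :+ q) :- :con 0ℚ) := (:- p) :- q) ≈-reflₚ p q) (units-neg p+q≈0)

    𝔐-isWellDefined : IsWellDefined (𝔐 C L)
    𝔐-isWellDefined = record
      { ≈-refl   = ≈ᵤ-refl
      ; ≈-sym    = ≈ᵤ-sym
      ; ≈-trans  = ≈ᵤ-trans
      ; +-cong   = ⊕-cong-≈ᵤ
      ; ·-cong   = ⊗-cong-≈ᵤ
      ; ≤-cong   = ≤ᶜ-respects-≈ᵤ
      ; Int-cong = L-respects-≈ᵤ
      }

    times≈conℤ⊗ : ∀ n p → times n p ≈ₚ conℤ (+ suc n) ⊗ p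
    times≈conℤ⊗ zero    p = ≈-symₚ (⊗-identityₚ p)
    times≈conℤ⊗ (suc n) p = begin
      times n p ⊕ p                  ≈⟨ ⊕-congₚ (times≈conℤ⊗ n p) ≈-reflₚ ⟩
      conℤ (+ suc n) ⊗ p ⊕ p         ≈⟨ solve 2 (λ m p → m :* p :+ p := (:con 1ℚ :+ m) :* p) ≈-reflₚ (conℤ (+ suc n)) p ⟩
      (con 1ℚ ⊕ conℤ (+ suc n)) ⊗ p  ≈⟨ ⊗-congₚ (conℤ-+ (+ 1) (+ suc n)) ≈-reflₚ ⟩
      conℤ (+ suc (suc n)) ⊗ p       ∎

    times-1≈conℤ : ∀ n → times n (con 1ℚ) ≈ₚ conℤ (+ suc n)
    times-1≈conℤ n = ≈-transₚ (times≈conℤ⊗ n (con 1ℚ)) (CommutativeRing.*-identityʳ Poly-commutativeRing _)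

    IntLit⇒≈conℤ : ∀ m c → IntLit m c → c ≈ᵤ conℤ m
    IntLit⇒≈conℤ (+ zero)  c c≈0   = c≈0
    IntLit⇒≈conℤ (+ suc n) c c≈n   = ≈ᵤ-trans c≈n (≈ₚ⇒≈ᵤ (times-1≈conℤ n))
    IntLit⇒≈conℤ -[1+ n ]  c c+n≈0 =
      ≈ᵤ-trans (≈ₚ⇒≈ᵤ c≈c+n-n) (≈ᵤ-trans (⊕-cong-≈ᵤ c+n≈0 ≈ᵤ-refl) (≈ₚ⇒≈ᵤ 0-n≈-n))
      where
      n′ : Poly X
      n′ = times n (con 1ℚ)
      c≈c+n-n : c ≈ₚ (c ⊕ n′) ⊕ negₚ n′
      c≈c+n-n = solve 2 (λ c n′ → c := (c :+ n′) :- n′) ≈-reflₚ c n′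
      0-n≈-n : con 0ℚ ⊕ negₚ n′ ≈ₚ conℤ -[1+ n ]
      0-n≈-n = begin
        con 0ℚ ⊕ negₚ n′         ≈⟨ ⊕-identityₚ _ ⟩
        negₚ n′                  ≈⟨ ⊗-congₚ ≈-reflₚ (times-1≈conℤ n) ⟩
        negₚ (conℤ (+ suc n))    ≈⟨ negₚ-conℤ (+ suc n) ⟩
        conℤ -[1+ n ]            ∎

    times-divisible : ∀ n → Σ (Poly X) λ p → times n p ≈ᵤ con 1ℚ
    times-divisible n = con (1/suc n) ,
      ≈ₚ⇒≈ᵤ (≈-transₚ (times≈conℤ⊗ n _) (conℤ-suc⊗inverse n))

    times-torsionFree : ∀ n p → con 0ℚ ≤ᶜ times n p → con 0ℚ ≤ᶜ p
    times-torsionFree n p 0≤np =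
      ∈⇒0≤ᶜ (conℤ-suc⊗-cancel n (0≤ᶜ⇒∈ (≤ᶜ-respects-≈ᵤ ≈ᵤ-refl (≈ₚ⇒≈ᵤ (times≈conℤ⊗ n p)) 0≤np)))

    Int-cut : CuttingPlaneClosed C L →
              ∀ (n : ℕ) (m : ℤ) p c d → IntLit m c → IntLit (m /ℕ suc n) d →
              L p → con 0ℚ ≤ᶜ times n p ⊕ c → con 0ℚ ≤ᶜ p ⊕ d
    Int-cut cut n m p c d c≈m d≈m/n p∈ 0≤np+c =
      ≤ᶜ-respects-≈ᵤ ≈ᵤ-refl (⊕-cong-≈ᵤ ≈ᵤ-refl (≈ᵤ-sym (IntLit⇒≈conℤ (m /ℕ suc n) d d≈m/n)))
        (∈⇒0≤ᶜ (cut n m p p∈ (0≤ᶜ⇒∈ 0≤np+m)))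
      where
      0≤np+m : con 0ℚ ≤ᶜ conℤ (+ suc n) ⊗ p ⊕ conℤ m
      0≤np+m = ≤ᶜ-respects-≈ᵤ ≈ᵤ-refl (⊕-cong-≈ᵤ (≈ₚ⇒≈ᵤ (times≈conℤ⊗ n p)) (IntLit⇒≈conℤ m c c≈m)) 0≤np+c

    𝔐-isLIRRModel : L (con 1ℚ) → Consistent C → CuttingPlaneClosed C L → IsLIRRModel (𝔐 C L)
    𝔐-isLIRRModel 1∈L consistent cut = record
      { +-assoc     = λ p q r → ≈ₚ⇒≈ᵤ (⊕-assocₚ p q r)
      ; +-comm      = λ p q → ≈ₚ⇒≈ᵤ (⊕-commₚ p q)
      ; +-identity  = λ p → ≈ₚ⇒≈ᵤ (⊕-identityₚ p)
      ; +-inverse   = λ p → negₚ p , ≈ₚ⇒≈ᵤ (⊕-inverseₚ p)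
      ; ·-assoc     = λ p q r → ≈ₚ⇒≈ᵤ (⊗-assocₚ p q r)
      ; ·-comm      = λ p q → ≈ₚ⇒≈ᵤ (⊗-commₚ p q)
      ; ·-identity  = λ p → ≈ₚ⇒≈ᵤ (⊗-identityₚ p)
      ; distrib     = λ p q r → ≈ₚ⇒≈ᵤ (distribₚ p q r)
      ; ≤-refl      = ≤ᶜ-refl
      ; ≤-trans     = ≤ᶜ-trans
      ; ≤-antisym   = ≤ᶜ-antisym
      ; ≤-+         = ⊕-monoˡ-≤ᶜ
      ; 0≤1         = 0≤ᶜ1
      ; 0≉1         = consistent⇒0≉ᵤ1 consistent
      ; divisible   = times-divisible
      ; torsionFree = times-torsionFree
      ; Int-1       = 1∈L
      ; Int-+       = L-+
      ; Int-neg     = L-neg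
      ; Int-cut     = Int-cut cut
      }

lemma4p1 : {X : Set} (C L : Poly X → Set) →
           Coherent C L → L (con 1ℚ) → Consistent C → CuttingPlaneClosed C L →
           IsWellDefined (𝔐 C L) × IsLIRRModel (𝔐 C L)
lemma4p1 C L (reg , _ , vs , L⇔) 1∈L consistent cut =
  𝔐-isWellDefined reg vs L⇔ , 𝔐-isLIRRModel reg vs L⇔ 1∈L consistent cut
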